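{- Let $\boldsymbol{Z}=\{z_{i,j}\in\mathbb{F}^2: i,j\in\mathbb{N}\}$ be a node set and define $\boldsymbol{LZ}=\{w_{i,j}=z_{i+1,j}: i,j\in\mathbb{N}\}$ and $\boldsymbol{DZ}=\{w_{i,j}=z_{i,j+1}: i,j\in\mathbb{N}\}$. Then for all $m,n\in\mathbb{N}$, $$\Delta_x\tilde g_{m,n}((x,y);\boldsymbol{Z})=m\,\tilde g_{m-1,n}((x,y);\boldsymbol{LZ}),\qquad \Delta_y\tilde g_{m,n}((x,y);\boldsymbol{Z})=n\,\tilde g_{m,n-1}((x,y);\boldsymbol{DZ}),$$ where the right-hand side is interpreted as $0$ when $m=0$ (respectively $n=0$).
   Context: $\mathbb{F}$ is a field of characteristic zero. For $p\in\mathbb{F}[x,y]$, $\Delta_x p(x,y)=p(x,y)-p(x-1,y)$ and $\Delta_y p(x,y)=p(x,y)-p(x,y-1)$. For $z\in\mathbb{F}^2$, $\varepsilon(z)$ denotes evaluation at $(x,y)=z$. Write $(i,j)\preceq(m,n)$ if $i\le m$ and $j\le n$. $\Pi^2_{m,n}$ is the space of polynomials of degree at most $m$ in $x$ and at most $n$ in $y$. For a node set $\boldsymbol{W}=\{w_{i,j}\}$ and $m,n\in\mathbb{N}$, $\tilde g_{m,n}((x,y);\boldsymbol{W})$ is the unique polynomial in $\Pi^2_{m,n}$ with $\varepsilon(w_{i,j})\Delta_x^i\Delta_y^j\tilde g_{m,n}((x,y);\boldsymbol{W})=m!\,n!\,\delta_{m,i}\delta_{n,j}$ for all $(i,j)\preceq(m,n)$.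 -}

module Defs where

open import Level using (_⊔_)
open import Data.Nat using (ℕ; zero; suc; _≤_) renaming (_*_ to _*ℕ_)
open import Data.Nat using (_!)
open import Data.Product using (_×_; Σ; ∃)
open import Relation.Nullary using (¬_)
open import Algebra.Bundles using (CommutativeRing)

-- Generic definitions over a commutative ring R (the field 𝔽 is a commutative
-- ring with the extra structure given by IsField below).
module _ {c ℓ} (R : CommutativeRing c ℓ) where
  open CommutativeRing R renaming (Carrier to F)

  ⟦_⟧ℕ : ℕ → F
  ⟦ zero ⟧ℕ = 0#
  ⟦ suc k ⟧ℕ = 1# + ⟦ k ⟧ℕ

  _^_ : F → ℕ → F
  x ^ zero = 1#
  x ^ suc k = x * (x ^ k)

  Σ≤ : ℕ → (ℕ → F) → F
  Σ≤ zero f = f 0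
  Σ≤ (suc k) f = Σ≤ k f + f (suc k)

  record IsField : Set (c ⊔ ℓ) where
    field
      1≉0 : ¬ (1# ≈ 0#)
      inverse : ∀ a → ¬ (a ≈ 0#) → Σ F (λ b → (a * b) ≈ 1#)

  CharZero : Set ℓ
  CharZero = ∀ k → ¬ (⟦ suc k ⟧ℕ ≈ 0#)

  -- Bivariate polynomials are represented by their polynomial functions
  -- F → F → F (over an infinite field this is faithful).
  Fun2 : Set c
  Fun2 = F → F → F

  InΠ : ℕ → ℕ → Fun2 → Set (c ⊔ ℓ)
  InΠ m n p = ∃ λ (coef : ℕ → ℕ → F) →
    ∀ x y → p x y ≈ Σ≤ m (λ i → Σ≤ n (λ j → coef i j * ((x ^ i) * (y ^ j))))

  Δx : Fun2 → Fun2
  Δx p x y = p x y - p (x - 1#) y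

  Δy : Fun2 → Fun2
  Δy p x y = p x y - p x (y - 1#)

  iter : ℕ → (Fun2 → Fun2) → Fun2 → Fun2
  iter zero D p = p
  iter (suc k) D p = D (iter k D p)

  Node : Set c
  Node = F × F

  NodeSet : Set c
  NodeSet = ℕ → ℕ → Node

  ε : Node → Fun2 → F
  ε (a Data.Product., b) p = p a b

  target : ℕ → ℕ → ℕ → ℕ → F
  target m n i j with Data.Nat._≟_ i m | Data.Nat._≟_ j n
  ... | Relation.Nullary.yes _ | Relation.Nullary.yes _ = ⟦ (m !) *ℕ (n !) ⟧ℕ
  ... | _ | _ = 0#

  -- p is  g̃_{m,n}((x,y); W)  (the unique polynomial with these properties)
  IsGtilde : ℕ → ℕ → NodeSet → Fun2 → Set (c ⊔ ℓ)
  IsGtilde m n W p =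
    InΠ m n p ×
    (∀ i j → i ≤ m → j ≤ n →
       ε (W i j) (iter i Δx (iter j Δy p)) ≈ target m n i j)

  LZ : NodeSet → NodeSet
  LZ Z i j = Z (suc i) j

  DZ : NodeSet → NodeSet
  DZ Z i j = Z i (suc j)

-- Uniqueness drives the proof: if r has degree ≤ m in x and ≤ n in y and all its data
-- ε(w_{i,j}) Δx^i Δy^j r with (i,j) ⪯ (m,n) vanish, then r = 0. Indeed Δx r has vanishing data
-- on LW and degree ≤ m - 1 in x, so Δx r = 0 by induction, and likewise Δy r = 0. A polynomial f
-- in one variable with f(t) = f(t - 1) agrees with a constant at the distinct points s, s - 1, …
-- (characteristic zero), so r is constant, equal to its value 0 at w_{0,0}. Since
-- Δx^i Δy^j Δx = Δx^{i+1} Δy^j, the function Δx g̃_{m,n}(Z) has the data of m g̃_{m-1,n}(LZ),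
-- and uniqueness identifies the two; similarly for Δy.
module Submission where

open import Level using (_⊔_)
open import Algebra.Bundles using (CommutativeRing)
open import Algebra.Solver.Ring.AlmostCommutativeRing
  using (fromCommutativeRing; _-Raw-AlmostCommutative⟶_)
open import Data.Empty using (⊥-elim)
open import Data.Integer as ℤ using (ℤ; +_; -[1+_]; sign; ∣_∣)
import Data.Integer.Properties as ℤₚ
open import Data.Maybe using (Maybe; just; nothing)
open import Data.Nat as ℕ using (ℕ; zero; suc; _≤_; _<_; z≤n; s≤s; _!)
import Data.Nat.Properties as ℕₚ
open import Data.Product using (_×_; _,_; ∃; ∃₂; proj₁; proj₂)
open import Data.Sign as Sign using (Sign)
open import Function using (id; _∘_; _⇔_; mk⇔; Equivalence)
open import Relation.Nullary using (¬_; yes; no)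
open import Relation.Binary.PropositionalEquality using (_≡_)
import Relation.Binary.PropositionalEquality as ≡
open import Defs

module _ {c ℓ} (R : CommutativeRing c ℓ) where
  open CommutativeRing R renaming (Carrier to F)
  open import Algebra.Definitions _≈_ using (AlmostLeftCancellative)
  open import Algebra.Properties.Ring ring
    using (-‿involutive; -0#≈0#; -‿+-comm; -1*x≈-x; x∙y⁻¹≈ε⇒x≈y; x≈y⇒x∙y⁻¹≈ε)
  open import Algebra.Properties.CommutativeSemigroup *-commutativeSemigroup
    using (interchange; xy∙z≈y∙xz)
  open import Relation.Binary.Reasoning.Setoid setoid

  private
    ⟦_⟧ : ℕ → F
    ⟦_⟧ = ⟦_⟧ℕ R

  -- Integer coefficients for the ring solver

  ⟦⟧-+ : ∀ m n → ⟦ m ℕ.+ n ⟧ ≈ ⟦ m ⟧ + ⟦ n ⟧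
  ⟦⟧-+ zero    n = sym (+-identityˡ _)
  ⟦⟧-+ (suc m) n = trans (+-congˡ (⟦⟧-+ m n)) (sym (+-assoc _ _ _))

  ⟦⟧-* : ∀ m n → ⟦ m ℕ.* n ⟧ ≈ ⟦ m ⟧ * ⟦ n ⟧
  ⟦⟧-* zero    n = sym (zeroˡ _)
  ⟦⟧-* (suc m) n = begin
    ⟦ n ℕ.+ m ℕ.* n ⟧           ≈⟨ ⟦⟧-+ n (m ℕ.* n) ⟩
    ⟦ n ⟧ + ⟦ m ℕ.* n ⟧         ≈⟨ +-cong (sym (*-identityˡ _)) (⟦⟧-* m n) ⟩
    1# * ⟦ n ⟧ + ⟦ m ⟧ * ⟦ n ⟧  ≈⟨ distribʳ _ _ _ ⟨
    (1# + ⟦ m ⟧) * ⟦ n ⟧        ∎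

  ⟦_⟧ₛ : Sign → F
  ⟦ Sign.+ ⟧ₛ = 1#
  ⟦ Sign.- ⟧ₛ = - 1#

  ⟦⟧ₛ-* : ∀ s t → ⟦ s Sign.* t ⟧ₛ ≈ ⟦ s ⟧ₛ * ⟦ t ⟧ₛ
  ⟦⟧ₛ-* Sign.+ t      = sym (*-identityˡ _)
  ⟦⟧ₛ-* Sign.- Sign.+ = sym (*-identityʳ _)
  ⟦⟧ₛ-* Sign.- Sign.- = sym (trans (-1*x≈-x (- 1#)) (-‿involutive 1#))

  ⟦_⟧ℤ : ℤ → F
  ⟦ + n      ⟧ℤ = ⟦ n ⟧
  ⟦ -[1+ n ] ⟧ℤ = - ⟦ suc n ⟧

  ⟦⟧ℤ-⊖ : ∀ m n → ⟦ m ℤ.⊖ n ⟧ℤ ≈ ⟦ m ⟧ - ⟦ n ⟧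
  ⟦⟧ℤ-⊖ zero    zero    = sym (-‿inverseʳ 0#)
  ⟦⟧ℤ-⊖ zero    (suc n) = sym (+-identityˡ _)
  ⟦⟧ℤ-⊖ (suc m) zero    = sym (trans (+-congˡ -0#≈0#) (+-identityʳ _))
  ⟦⟧ℤ-⊖ (suc m) (suc n) = begin
    ⟦ suc m ℤ.⊖ suc n ⟧ℤ              ≡⟨ ≡.cong ⟦_⟧ℤ (ℤₚ.[1+m]⊖[1+n]≡m⊖n m n) ⟩
    ⟦ m ℤ.⊖ n ⟧ℤ                      ≈⟨ ⟦⟧ℤ-⊖ m n ⟩
    ⟦ m ⟧ - ⟦ n ⟧                     ≈⟨ +-congˡ (-‿cong (+-identityˡ _)) ⟨
    ⟦ m ⟧ - (0# + ⟦ n ⟧)              ≈⟨ +-congˡ (-‿cong (+-congʳ (-‿inverseˡ 1#))) ⟨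
    ⟦ m ⟧ - ((- 1# + 1#) + ⟦ n ⟧)     ≈⟨ +-congˡ (-‿cong (+-assoc _ _ _)) ⟩
    ⟦ m ⟧ - (- 1# + (1# + ⟦ n ⟧))     ≈⟨ +-congˡ (-‿+-comm (- 1#) _) ⟨
    ⟦ m ⟧ + (- - 1# - (1# + ⟦ n ⟧))   ≈⟨ +-congˡ (+-congʳ (-‿involutive 1#)) ⟩
    ⟦ m ⟧ + (1# - (1# + ⟦ n ⟧))       ≈⟨ +-assoc _ _ _ ⟨
    (⟦ m ⟧ + 1#) - (1# + ⟦ n ⟧)       ≈⟨ +-congʳ (+-comm _ _) ⟩
    (1# + ⟦ m ⟧) - (1# + ⟦ n ⟧)       ∎

  ⟦⟧ℤ-+ : ∀ i j → ⟦ i ℤ.+ j ⟧ℤ ≈ ⟦ i ⟧ℤ + ⟦ j ⟧ℤ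
  ⟦⟧ℤ-+ (+ m)    (+ n)    = ⟦⟧-+ m n
  ⟦⟧ℤ-+ (+ m)    -[1+ n ] = ⟦⟧ℤ-⊖ m (suc n)
  ⟦⟧ℤ-+ -[1+ m ] (+ n)    = trans (⟦⟧ℤ-⊖ n (suc m)) (+-comm _ _)
  ⟦⟧ℤ-+ -[1+ m ] -[1+ n ] = begin
    - ⟦ suc (suc (m ℕ.+ n)) ⟧       ≡⟨ ≡.cong (λ k → - ⟦ suc k ⟧) (ℕₚ.+-suc m n) ⟨
    - ⟦ suc m ℕ.+ suc n ⟧           ≈⟨ -‿cong (⟦⟧-+ (suc m) (suc n)) ⟩
    - (⟦ suc m ⟧ + ⟦ suc n ⟧)       ≈⟨ -‿+-comm _ _ ⟨
    - ⟦ suc m ⟧ - ⟦ suc n ⟧         ∎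

  ⟦⟧ℤ-◃ : ∀ s n → ⟦ s ℤ.◃ n ⟧ℤ ≈ ⟦ s ⟧ₛ * ⟦ n ⟧
  ⟦⟧ℤ-◃ s      zero    = sym (zeroʳ _)
  ⟦⟧ℤ-◃ Sign.+ (suc n) = sym (*-identityˡ _)
  ⟦⟧ℤ-◃ Sign.- (suc n) = sym (-1*x≈-x _)

  ⟦⟧ℤ-* : ∀ i j → ⟦ i ℤ.* j ⟧ℤ ≈ ⟦ i ⟧ℤ * ⟦ j ⟧ℤ
  ⟦⟧ℤ-* i j = begin
    ⟦ i ℤ.* j ⟧ℤ
      ≈⟨ ⟦⟧ℤ-◃ (sign i Sign.* sign j) (∣ i ∣ ℕ.* ∣ j ∣) ⟩
    ⟦ sign i Sign.* sign j ⟧ₛ * ⟦ ∣ i ∣ ℕ.* ∣ j ∣ ⟧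
      ≈⟨ *-cong (⟦⟧ₛ-* (sign i) (sign j)) (⟦⟧-* ∣ i ∣ ∣ j ∣) ⟩
    (⟦ sign i ⟧ₛ * ⟦ sign j ⟧ₛ) * (⟦ ∣ i ∣ ⟧ * ⟦ ∣ j ∣ ⟧) ≈⟨ interchange _ _ _ _ ⟩
    (⟦ sign i ⟧ₛ * ⟦ ∣ i ∣ ⟧) * (⟦ sign j ⟧ₛ * ⟦ ∣ j ∣ ⟧) ≈⟨ *-cong (sign-abs i) (sign-abs j) ⟩
    ⟦ i ⟧ℤ * ⟦ j ⟧ℤ                                   ∎
    where
    sign-abs : ∀ k → ⟦ sign k ⟧ₛ * ⟦ ∣ k ∣ ⟧ ≈ ⟦ k ⟧ℤ
    sign-abs k = trans (sym (⟦⟧ℤ-◃ (sign k) ∣ k ∣)) (reflexive (≡.cong ⟦_⟧ℤ (ℤₚ.◃-inverse k)))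

  ⟦⟧ℤ-neg : ∀ i → ⟦ ℤ.- i ⟧ℤ ≈ - ⟦ i ⟧ℤ
  ⟦⟧ℤ-neg (+ zero)  = sym -0#≈0#
  ⟦⟧ℤ-neg (+ suc n) = refl
  ⟦⟧ℤ-neg -[1+ n ]  = sym (-‿involutive _)

  -- Unlike ⟦_⟧ℤ, fromℤ sends 1 to 1# itself, so that the constant con (+ 1)
  -- of a solver equation denotes 1#.
  fromℕ : ℕ → F
  fromℕ zero          = 0#
  fromℕ (suc zero)    = 1#
  fromℕ (suc (suc n)) = ⟦ suc (suc n) ⟧

  fromℤ : ℤ → F
  fromℤ (+ n)      = fromℕ n
  fromℤ -[1+ n ]   = - fromℕ (suc n)

  fromℕ≈⟦⟧ : ∀ n → fromℕ n ≈ ⟦ n ⟧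
  fromℕ≈⟦⟧ zero          = refl
  fromℕ≈⟦⟧ (suc zero)    = sym (+-identityʳ 1#)
  fromℕ≈⟦⟧ (suc (suc n)) = refl

  fromℤ≈⟦⟧ℤ : ∀ i → fromℤ i ≈ ⟦ i ⟧ℤ
  fromℤ≈⟦⟧ℤ (+ n)    = fromℕ≈⟦⟧ n
  fromℤ≈⟦⟧ℤ -[1+ n ] = -‿cong (fromℕ≈⟦⟧ (suc n))

  fromℤ-morphism : ℤ.+-*-rawRing -Raw-AlmostCommutative⟶ fromCommutativeRing R
  fromℤ-morphism = record
    { ⟦_⟧    = fromℤ
    ; +-homo = λ i j → transport (i ℤ.+ j) (⟦⟧ℤ-+ i j) (+-cong (fromℤ≈⟦⟧ℤ i) (fromℤ≈⟦⟧ℤ j))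
    ; *-homo = λ i j → transport (i ℤ.* j) (⟦⟧ℤ-* i j) (*-cong (fromℤ≈⟦⟧ℤ i) (fromℤ≈⟦⟧ℤ j))
    ; -‿homo = λ i → transport (ℤ.- i) (⟦⟧ℤ-neg i) (-‿cong (fromℤ≈⟦⟧ℤ i))
    ; 0-homo = refl
    ; 1-homo = refl
    }
    where
    transport : ∀ i {y z} → ⟦ i ⟧ℤ ≈ y → z ≈ y → fromℤ i ≈ z
    transport i eq eq′ = trans (fromℤ≈⟦⟧ℤ i) (trans eq (sym eq′))

  fromℤ-≟ : ∀ i j → Maybe (fromℤ i ≈ fromℤ j)
  fromℤ-≟ i j with i ℤ.≟ j
  ... | yes ≡.refl = just refl
  ... | no _       = nothing

  open import Algebra.Solver.Ring ℤ.+-*-rawRing (fromCommutativeRing R) fromℤ-morphism fromℤ-≟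
    using (solve; _:=_; con; _:+_; _:*_; _:-_; :-_)

  -- Polynomial functions of one variable

  Poly≤ : ℕ → (F → F) → Set (c ⊔ ℓ)
  Poly≤ zero    f = ∃ λ a → ∀ t → f t ≈ a
  Poly≤ (suc m) f = ∃₂ λ a g → Poly≤ m g × (∀ t → f t ≈ a + t * g t)

  Poly≤-resp : ∀ m {f g} → Poly≤ m f → (∀ t → g t ≈ f t) → Poly≤ m g
  Poly≤-resp zero    (a , f≈a)         g≈f = a , λ t → trans (g≈f t) (f≈a t)
  Poly≤-resp (suc m) (a , h , h≤ , f≈) g≈f = a , h , h≤ , λ t → trans (g≈f t) (f≈ t)

  Poly≤-cong : ∀ m {f} → Poly≤ m f → ∀ {s t} → s ≈ t → f s ≈ f t
  Poly≤-cong zero    (a , f≈a)         _   = trans (f≈a _) (sym (f≈a _))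
  Poly≤-cong (suc m) (a , g , g≤ , f≈) s≈t =
    trans (f≈ _) (trans (+-congˡ (*-cong s≈t (Poly≤-cong m g≤ s≈t))) (sym (f≈ _)))

  Poly≤-const : ∀ m a → Poly≤ m (λ _ → a)
  Poly≤-const zero    a = a , λ _ → refl
  Poly≤-const (suc m) a = a , (λ _ → 0#) , Poly≤-const m 0# ,
    λ t → sym (trans (+-congˡ (zeroʳ t)) (+-identityʳ a))

  Poly≤-suc : ∀ m {f} → Poly≤ m f → Poly≤ (suc m) f
  Poly≤-suc zero    (a , f≈a) = a , (λ _ → 0#) , (0# , λ _ → refl) ,
    λ t → trans (f≈a t) (sym (trans (+-congˡ (zeroʳ t)) (+-identityʳ a)))
  Poly≤-suc (suc m) (a , g , g≤ , f≈) = a , g , Poly≤-suc m g≤ , f≈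

  Poly≤-sub* : ∀ m {f g} → Poly≤ m f → Poly≤ m g → ∀ k → Poly≤ m (λ t → f t - k * g t)
  Poly≤-sub* zero (a , f≈a) (b , g≈b) k =
    a - k * b , λ t → +-cong (f≈a t) (-‿cong (*-congˡ (g≈b t)))
  Poly≤-sub* (suc m) (a , f′ , f′≤ , f≈) (b , g′ , g′≤ , g≈) k =
    a - k * b , (λ t → f′ t - k * g′ t) , Poly≤-sub* m f′≤ g′≤ k ,
    λ t → trans (+-cong (f≈ t) (-‿cong (*-congˡ (g≈ t)))) (horner a b k t (f′ t) (g′ t))
    where
    horner : ∀ a b k t u v → (a + t * u) - k * (b + t * v) ≈ (a - k * b) + t * (u - k * v)
    horner = solve 6 (λ a b k t u v →
      (a :+ t :* u) :- k :* (b :+ t :* v) := (a :- k :* b) :+ t :* (u :- k :* v)) refl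

  Poly≤-sub : ∀ m {f g} → Poly≤ m f → Poly≤ m g → Poly≤ m (λ t → f t - g t)
  Poly≤-sub m f≤ g≤ =
    Poly≤-resp m (Poly≤-sub* m f≤ g≤ 1#) (λ t → +-congˡ (-‿cong (sym (*-identityˡ _))))

  Poly≤-shift : ∀ m {f} → Poly≤ m f → ∀ s → Poly≤ m (λ t → f (t - s))
  Poly≤-shift zero    (a , f≈a)         s = a , λ t → f≈a (t - s)
  Poly≤-shift (suc m) (a , g , g≤ , f≈) s =
    Poly≤-resp (suc m) (Poly≤-sub* (suc m) expanded (Poly≤-suc m g-shifted≤) s)
      (λ t → trans (f≈ (t - s)) (expand a s t (g (t - s))))
    where
    g-shifted≤ : Poly≤ m (λ t → g (t - s))
    g-shifted≤ = Poly≤-shift m g≤ s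
    expanded : Poly≤ (suc m) (λ t → a + t * g (t - s))
    expanded = a , _ , g-shifted≤ , λ t → refl
    expand : ∀ a s t u → a + (t - s) * u ≈ (a + t * u) - s * u
    expand = solve 4 (λ a s t u → a :+ (t :- s) :* u := (a :+ t :* u) :- s :* u) refl

  -- f t - f (t - 1) = t (g t - g (t - 1)) + g (t - 1)  when  f t = a + t g t.
  Poly≤-Δ : ∀ m {f} → Poly≤ (suc m) f → Poly≤ m (λ t → f t - f (t - 1#))
  Poly≤-Δ zero (a , g , (d , g≈d) , f≈) = d , λ t →
    trans (+-cong (trans (f≈ t) (+-congˡ (*-congˡ (g≈d t))))
                  (-‿cong (trans (f≈ (t - 1#)) (+-congˡ (*-congˡ (g≈d (t - 1#)))))))
          (linear a t d)
    where
    linear : ∀ a t d → (a + t * d) - (a + (t - 1#) * d) ≈ d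
    linear = solve 3 (λ a t d → (a :+ t :* d) :- (a :+ (t :- con (+ 1)) :* d) := d) refl
  Poly≤-Δ (suc m) (a , g , g≤ , f≈) =
    Poly≤-resp (suc m) (Poly≤-sub* (suc m) tΔg≤ (Poly≤-shift (suc m) g≤ 1#) (- 1#))
      (λ t → trans (+-cong (f≈ t) (-‿cong (f≈ (t - 1#)))) (split a t (g t) (g (t - 1#))))
    where
    tΔg≤ : Poly≤ (suc m) (λ t → 0# + t * (g t - g (t - 1#)))
    tΔg≤ = 0# , _ , Poly≤-Δ m g≤ , λ t → refl
    split : ∀ a t u v → (a + t * u) - (a + (t - 1#) * v) ≈ (0# + t * (u - v)) - (- 1#) * v
    split = solve 4 (λ a t u v → (a :+ t :* u) :- (a :+ (t :- con (+ 1)) :* v)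
                              := (con (+ 0) :+ t :* (u :- v)) :- (:- con (+ 1)) :* v) refl

  Poly≤-factor : ∀ m {f} → Poly≤ (suc m) f → ∀ b →
    ∃ λ h → Poly≤ m h × (∀ t → f t ≈ f b + (t - b) * h t)
  Poly≤-factor zero {f} (a , g , (d , g≈d) , f≈) b = (λ _ → d) , (d , λ _ → refl) , λ t → begin
    f t                        ≈⟨ trans (f≈ t) (+-congˡ (*-congˡ (g≈d t))) ⟩
    a + t * d                  ≈⟨ recentre a t b d ⟩
    (a + b * d) + (t - b) * d  ≈⟨ +-congʳ (trans (f≈ b) (+-congˡ (*-congˡ (g≈d b)))) ⟨
    f b + (t - b) * d          ∎
    where
    recentre : ∀ a t b d → a + t * d ≈ (a + b * d) + (t - b) * d
    recentre = solve 4 (λ a t b d → a :+ t :* d := (a :+ b :* d) :+ (t :- b) :* d) refl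
  Poly≤-factor (suc m) (a , g , g≤ , f≈) b with Poly≤-factor m g≤ b
  ... | h , h≤ , g≈ = (λ t → g b + t * h t) , (g b , h , h≤ , λ t → refl) , λ t →
    trans (f≈ t) (trans (+-congˡ (*-congˡ (g≈ t)))
      (trans (recentre a t b (g b) (h t)) (+-congʳ (sym (f≈ b)))))
    where
    recentre : ∀ a t b c h → a + t * (c + (t - b) * h) ≈ (a + b * c) + (t - b) * (c + t * h)
    recentre = solve 5 (λ a t b c h →
      a :+ t :* (c :+ (t :- b) :* h) := (a :+ b :* c) :+ (t :- b) :* (c :+ t :* h)) refl

  Poly≤-power-sum : ∀ m (a : ℕ → F) → Poly≤ m (λ t → Σ≤ R m (λ i → a i * _^_ R t i))
  Poly≤-power-sum zero    a = a 0 , λ t → *-identityʳ (a 0)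
  Poly≤-power-sum (suc m) a =
    a 0 , _ , Poly≤-power-sum m (a ∘ suc) , λ t → horner m a t
    where
    horner : ∀ m (a : ℕ → F) t →
      Σ≤ R (suc m) (λ i → a i * _^_ R t i) ≈ a 0 + t * Σ≤ R m (λ i → a (suc i) * _^_ R t i)
    horner zero a t = solve 3 (λ t a₀ a₁ →
      a₀ :* con (+ 1) :+ a₁ :* (t :* con (+ 1)) := a₀ :+ t :* (a₁ :* con (+ 1))) refl t (a 0) (a 1)
    horner (suc m) a t = trans (+-congʳ (horner m a t)) (solve 5 (λ a₀ t S A T →
      (a₀ :+ t :* S) :+ A :* (t :* T) := a₀ :+ t :* (S :+ A :* T)) refl (a 0) t _ _ _)

  IsField⇒almostLeftCancellative : IsField R → AlmostLeftCancellative 0# _*_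
  IsField⇒almostLeftCancellative isField x y z x≉0 xy≈xz with IsField.inverse isField x x≉0
  ... | x⁻¹ , xx⁻¹≈1 = begin
    y              ≈⟨ *-identityˡ y ⟨
    1# * y         ≈⟨ *-congʳ xx⁻¹≈1 ⟨
    (x * x⁻¹) * y  ≈⟨ xy∙z≈y∙xz x x⁻¹ y ⟩
    x⁻¹ * (x * y)  ≈⟨ *-congˡ xy≈xz ⟩
    x⁻¹ * (x * z)  ≈⟨ xy∙z≈y∙xz x x⁻¹ z ⟨
    (x * x⁻¹) * z  ≈⟨ *-congʳ xx⁻¹≈1 ⟩
    1# * z         ≈⟨ *-identityˡ z ⟩
    z              ∎

  module _ (cancel : AlmostLeftCancellative 0# _*_) where

    Poly≤-roots : ∀ m {f} → Poly≤ m f → (b : ℕ → F) → (∀ {i j} → i < j → ¬ b j - b i ≈ 0#) →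
      (∀ k → k ≤ m → f (b k) ≈ 0#) → ∀ t → f t ≈ 0#
    Poly≤-roots zero (a , f≈a) b _ f[b]≈0 t =
      trans (f≈a t) (trans (sym (f≈a (b 0))) (f[b]≈0 0 z≤n))
    Poly≤-roots (suc m) {f} f≤ b distinct f[b]≈0 t with Poly≤-factor m f≤ (b 0)
    ... | h , h≤ , f≈ = begin
      f t                        ≈⟨ f≈ t ⟩
      f (b 0) + (t - b 0) * h t  ≈⟨ +-cong (f[b]≈0 0 z≤n) (*-congˡ (h≈0 t)) ⟩
      0# + (t - b 0) * 0#        ≈⟨ trans (+-identityˡ _) (zeroʳ _) ⟩
      0#                         ∎
      where
      h[b]≈0 : ∀ k → k ≤ m → h (b (suc k)) ≈ 0#
      h[b]≈0 k k≤m = cancel (b (suc k) - b 0) _ _ (distinct (s≤s z≤n)) (begin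
        (b (suc k) - b 0) * h (b (suc k))            ≈⟨ +-identityˡ _ ⟨
        0# + (b (suc k) - b 0) * h (b (suc k))       ≈⟨ +-congʳ (f[b]≈0 0 z≤n) ⟨
        f (b 0) + (b (suc k) - b 0) * h (b (suc k))  ≈⟨ f≈ (b (suc k)) ⟨
        f (b (suc k))                                ≈⟨ f[b]≈0 (suc k) (s≤s k≤m) ⟩
        0#                                           ≈⟨ zeroʳ _ ⟨
        (b (suc k) - b 0) * 0#                       ∎)
      h≈0 : ∀ t → h t ≈ 0#
      h≈0 = Poly≤-roots m h≤ (b ∘ suc) (λ i<j → distinct (s≤s i<j)) h[b]≈0

  module _ (charZero : CharZero R) where

    ⟦⟧-distinct : ∀ {i j} → i < j → ¬ ⟦ i ⟧ - ⟦ j ⟧ ≈ 0#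
    ⟦⟧-distinct {zero} {suc j} _ 0-j≈0 = charZero j (begin
      ⟦ suc j ⟧             ≈⟨ -‿involutive _ ⟨
      - (- ⟦ suc j ⟧)       ≈⟨ -‿cong (+-identityˡ _) ⟨
      - (0# - ⟦ suc j ⟧)    ≈⟨ -‿cong 0-j≈0 ⟩
      - 0#                  ≈⟨ -0#≈0# ⟩
      0#                    ∎)
    ⟦⟧-distinct {suc i} {suc j} (s≤s i<j) i-j≈0 =
      ⟦⟧-distinct i<j (trans (solve 2 (λ a b → a :- b := (con (+ 1) :+ a) :- (con (+ 1) :+ b))
                                      refl ⟦ i ⟧ ⟦ j ⟧) i-j≈0)

  module _ (cancel : AlmostLeftCancellative 0# _*_) (charZero : CharZero R) where

    Poly≤-periodic⇒const : ∀ m {f} → Poly≤ m f → (∀ t → f t ≈ f (t - 1#)) → ∀ s t → f t ≈ f s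
    Poly≤-periodic⇒const m {f} f≤ periodic s t = x∙y⁻¹≈ε⇒x≈y _ _
      (Poly≤-roots cancel m (Poly≤-sub m f≤ (Poly≤-const m (f s))) nodes distinct
         (λ k _ → x≈y⇒x∙y⁻¹≈ε (f[nodes]≈f[s] k)) t)
      where
      nodes : ℕ → F
      nodes k = s - ⟦ k ⟧
      f[nodes]≈f[s] : ∀ k → f (nodes k) ≈ f s
      f[nodes]≈f[s] zero    = Poly≤-cong m f≤ (trans (+-congˡ -0#≈0#) (+-identityʳ s))
      f[nodes]≈f[s] (suc k) =
        trans (Poly≤-cong m f≤ step) (trans (sym (periodic _)) (f[nodes]≈f[s] k))
        where
        step : s - (1# + ⟦ k ⟧) ≈ (s - ⟦ k ⟧) - 1#
        step = solve 2 (λ s k → s :- (con (+ 1) :+ k) := (s :- k) :- con (+ 1)) refl s ⟦ k ⟧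
      distinct : ∀ {i j} → i < j → ¬ nodes j - nodes i ≈ 0#
      distinct {i} {j} i<j = ⟦⟧-distinct charZero i<j ∘ trans (solve 3 (λ s i j →
        i :- j := (s :- j) :- (s :- i)) refl s ⟦ i ⟧ ⟦ j ⟧)

  -- Functions of two variables and their differences

  infix 4 _≈₂_
  record _≈₂_ (p q : Fun2 R) : Set (c ⊔ ℓ) where
    constructor pointwise
    field at : ∀ x y → p x y ≈ q x y
  open _≈₂_ public

  ≈₂-refl : ∀ {p} → p ≈₂ p
  ≈₂-refl = pointwise λ _ _ → refl

  ≈₂-trans : ∀ {p q r} → p ≈₂ q → q ≈₂ r → p ≈₂ r
  ≈₂-trans p≈q q≈r = pointwise λ x y → trans (at p≈q x y) (at q≈r x y)

  _⊝[_]_ : Fun2 R → F → Fun2 R → Fun2 R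
  (p ⊝[ k ] q) x y = p x y - k * q x y

  Congruent₂ : (Fun2 R → Fun2 R) → Set (c ⊔ ℓ)
  Congruent₂ D = ∀ {p q} → p ≈₂ q → D p ≈₂ D q

  Linear₂ : (Fun2 R → Fun2 R) → Set (c ⊔ ℓ)
  Linear₂ D = ∀ k p q → D (p ⊝[ k ] q) ≈₂ D p ⊝[ k ] D q

  Δx-cong : Congruent₂ (Δx R)
  Δx-cong p≈q = pointwise λ x y → +-cong (at p≈q x y) (-‿cong (at p≈q (x - 1#) y))

  Δy-cong : Congruent₂ (Δy R)
  Δy-cong p≈q = pointwise λ x y → +-cong (at p≈q x y) (-‿cong (at p≈q x (y - 1#)))

  private
    sub-linear : ∀ a b c d k → (a - k * b) - (c - k * d) ≈ (a - c) - k * (b - d)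
    sub-linear = solve 5 (λ a b c d k →
      (a :- k :* b) :- (c :- k :* d) := (a :- c) :- k :* (b :- d)) refl

  Δx-linear : Linear₂ (Δx R)
  Δx-linear k p q = pointwise λ x y → sub-linear _ _ _ _ k

  Δy-linear : Linear₂ (Δy R)
  Δy-linear k p q = pointwise λ x y → sub-linear _ _ _ _ k

  Δy∘Δx≈Δx∘Δy : ∀ p → Δy R (Δx R p) ≈₂ Δx R (Δy R p)
  Δy∘Δx≈Δx∘Δy p = pointwise λ x y →
    solve 4 (λ a b c d → (a :- b) :- (c :- d) := (a :- c) :- (b :- d)) refl
      (p x y) (p (x - 1#) y) (p x (y - 1#)) (p (x - 1#) (y - 1#))

  iter-cong : ∀ D → Congruent₂ D → ∀ k → Congruent₂ (iter R k D)
  iter-cong D D-cong zero    p≈q = p≈q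
  iter-cong D D-cong (suc k) p≈q = D-cong (iter-cong D D-cong k p≈q)

  iter-linear : ∀ D → Congruent₂ D → Linear₂ D → ∀ n → Linear₂ (iter R n D)
  iter-linear D D-cong D-linear zero    k p q = ≈₂-refl
  iter-linear D D-cong D-linear (suc n) k p q =
    ≈₂-trans (D-cong (iter-linear D D-cong D-linear n k p q)) (D-linear k _ _)

  iter-comm : ∀ (D E : Fun2 R → Fun2 R) → Congruent₂ E → (∀ p → E (D p) ≈₂ D (E p)) →
    ∀ k p → iter R k E (D p) ≈₂ D (iter R k E p)
  iter-comm D E E-cong E∘D≈D∘E zero    p = ≈₂-refl
  iter-comm D E E-cong E∘D≈D∘E (suc k) p =
    ≈₂-trans (E-cong (iter-comm D E E-cong E∘D≈D∘E k p)) (E∘D≈D∘E _)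

  Δ[_,_] : ℕ → ℕ → Fun2 R → Fun2 R
  Δ[ i , j ] p = iter R i (Δx R) (iter R j (Δy R) p)

  Δ[]-linear : ∀ i j → Linear₂ Δ[ i , j ]
  Δ[]-linear i j k p q = ≈₂-trans
    (iter-cong (Δx R) Δx-cong i (iter-linear (Δy R) Δy-cong Δy-linear j k p q))
    (iter-linear (Δx R) Δx-cong Δx-linear i k _ _)

  Δ[]-Δx : ∀ i j p → Δ[ i , j ] (Δx R p) ≈₂ Δ[ suc i , j ] p
  Δ[]-Δx i j p = ≈₂-trans
    (iter-cong (Δx R) Δx-cong i (iter-comm (Δx R) (Δy R) Δy-cong Δy∘Δx≈Δx∘Δy j p))
    (iter-comm (Δx R) (Δx R) Δx-cong (λ _ → ≈₂-refl) i _)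

  Δ[]-Δy : ∀ i j p → Δ[ i , j ] (Δy R p) ≈₂ Δ[ i , suc j ] p
  Δ[]-Δy i j p = iter-cong (Δx R) Δx-cong i (iter-comm (Δy R) (Δy R) Δy-cong (λ _ → ≈₂-refl) j p)

  ε-cong : ∀ z {p q} → p ≈₂ q → ε R z p ≈ ε R z q
  ε-cong (a , b) p≈q = at p≈q a b

  -- Separate degree bounds in each variable are all that the uniqueness argument uses.
  Poly₂≤ : ℕ → ℕ → Fun2 R → Set (c ⊔ ℓ)
  Poly₂≤ m n p = (∀ y → Poly≤ m (λ x → p x y)) × (∀ x → Poly≤ n (p x))

  Poly₂≤-⊝ : ∀ {m n p q} → Poly₂≤ m n p → Poly₂≤ m n q → ∀ k → Poly₂≤ m n (p ⊝[ k ] q)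
  Poly₂≤-⊝ {m} {n} (pˣ , pʸ) (qˣ , qʸ) k =
    (λ y → Poly≤-sub* m (pˣ y) (qˣ y) k) , (λ x → Poly≤-sub* n (pʸ x) (qʸ x) k)

  Poly₂≤-Δx : ∀ {m n p} → Poly₂≤ (suc m) n p → Poly₂≤ m n (Δx R p)
  Poly₂≤-Δx {m} {n} (pˣ , pʸ) = (λ y → Poly≤-Δ m (pˣ y)) , (λ x → Poly≤-sub n (pʸ x) (pʸ (x - 1#)))

  Poly₂≤-Δy : ∀ {m n p} → Poly₂≤ m (suc n) p → Poly₂≤ m n (Δy R p)
  Poly₂≤-Δy {m} {n} (pˣ , pʸ) = (λ y → Poly≤-sub m (pˣ y) (pˣ (y - 1#))) , (λ x → Poly≤-Δ n (pʸ x))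

  Poly₂≤[0,n]⇒Δx≈0 : ∀ {n p} → Poly₂≤ 0 n p → Δx R p ≈₂ λ _ _ → 0#
  Poly₂≤[0,n]⇒Δx≈0 (pˣ , _) = pointwise λ x y →
    let (a , p≈a) = pˣ y in trans (+-cong (p≈a x) (-‿cong (p≈a (x - 1#)))) (-‿inverseʳ a)

  Poly₂≤[m,0]⇒Δy≈0 : ∀ {m p} → Poly₂≤ m 0 p → Δy R p ≈₂ λ _ _ → 0#
  Poly₂≤[m,0]⇒Δy≈0 (_ , pʸ) = pointwise λ x y →
    let (a , p≈a) = pʸ x in trans (+-cong (p≈a y) (-‿cong (p≈a (y - 1#)))) (-‿inverseʳ a)

  Σ≤-cong : ∀ m {f g} → (∀ i → f i ≈ g i) → Σ≤ R m f ≈ Σ≤ R m g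
  Σ≤-cong zero    f≈g = f≈g 0
  Σ≤-cong (suc m) f≈g = +-cong (Σ≤-cong m f≈g) (f≈g (suc m))

  Σ≤-+ : ∀ m f g → Σ≤ R m (λ i → f i + g i) ≈ Σ≤ R m f + Σ≤ R m g
  Σ≤-+ zero    f g = refl
  Σ≤-+ (suc m) f g = trans (+-congʳ (Σ≤-+ m f g)) (interchange⁺ _ _ _ _)
    where open import Algebra.Properties.CommutativeSemigroup +-commutativeSemigroup
            renaming (interchange to interchange⁺)

  Σ≤-*ʳ : ∀ m f z → Σ≤ R m f * z ≈ Σ≤ R m (λ i → f i * z)
  Σ≤-*ʳ zero    f z = refl
  Σ≤-*ʳ (suc m) f z = trans (distribʳ z _ _) (+-congʳ (Σ≤-*ʳ m f z))

  Σ≤-comm : ∀ m n (a : ℕ → ℕ → F) →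
    Σ≤ R m (λ i → Σ≤ R n (a i)) ≈ Σ≤ R n (λ j → Σ≤ R m (λ i → a i j))
  Σ≤-comm m zero    a = refl
  Σ≤-comm m (suc n) a = trans (Σ≤-+ m _ _) (+-congʳ (Σ≤-comm m n a))

  InΠ⇒Poly₂≤ : ∀ m n {p} → InΠ R m n p → Poly₂≤ m n p
  InΠ⇒Poly₂≤ m n {p} (a , p≈) = pˣ , pʸ
    where
    xʲ : F → ℕ → F
    xʲ = _^_ R
    pˣ : ∀ y → Poly≤ m (λ x → p x y)
    pˣ y = Poly≤-resp m (Poly≤-power-sum m (λ i → Σ≤ R n (λ j → a i j * xʲ y j))) λ x →
      trans (p≈ x y) (Σ≤-cong m λ i →
        trans (Σ≤-cong n (λ j → solve 3 (λ c X Y → c :* (X :* Y) := (c :* Y) :* X) refl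
                                      (a i j) (xʲ x i) (xʲ y j)))
              (sym (Σ≤-*ʳ n _ (xʲ x i))))
    pʸ : ∀ x → Poly≤ n (p x)
    pʸ x = Poly≤-resp n (Poly≤-power-sum n (λ j → Σ≤ R m (λ i → a i j * xʲ x i))) λ y →
      trans (p≈ x y) (trans (Σ≤-comm m n _) (Σ≤-cong n λ j →
        trans (Σ≤-cong m (λ i → sym (*-assoc _ _ _)))
              (sym (Σ≤-*ʳ m _ (xʲ y j)))))

  target-diag : ∀ m n → target R m n m n ≈ ⟦ m ! ℕ.* n ! ⟧
  target-diag m n with m ℕ.≟ m | n ℕ.≟ n
  ... | yes _  | yes _  = refl
  ... | no m≢m | _      = ⊥-elim (m≢m ≡.refl)
  ... | yes _  | no n≢n = ⊥-elim (n≢n ≡.refl)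

  target-off : ∀ m n i j → ¬ (i ≡ m × j ≡ n) → target R m n i j ≈ 0#
  target-off m n i j ¬diag with i ℕ.≟ m | j ℕ.≟ n
  ... | yes i≡m | yes j≡n = ⊥-elim (¬diag (i≡m , j≡n))
  ... | no _    | _       = refl
  ... | yes _   | no _    = refl

  target-scale : ∀ {m n i j m′ n′ i′ j′} k → (i′ ≡ m′ ⇔ i ≡ m) → (j′ ≡ n′ ⇔ j ≡ n) →
    m′ ! ℕ.* n′ ! ≡ k ℕ.* (m ! ℕ.* n !) → target R m′ n′ i′ j′ ≈ ⟦ k ⟧ * target R m n i j
  target-scale {m} {n} {i} {j} {m′} {n′} k i⇔ j⇔ factorials with i ℕ.≟ m | j ℕ.≟ n
  ... | yes ≡.refl | yes ≡.refl with Equivalence.from i⇔ ≡.refl | Equivalence.from j⇔ ≡.refl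
  ...   | ≡.refl | ≡.refl = begin
    target R m′ n′ m′ n′        ≈⟨ target-diag m′ n′ ⟩
    ⟦ m′ ! ℕ.* n′ ! ⟧           ≡⟨ ≡.cong ⟦_⟧ factorials ⟩
    ⟦ k ℕ.* (m ! ℕ.* n !) ⟧     ≈⟨ ⟦⟧-* k _ ⟩
    ⟦ k ⟧ * ⟦ m ! ℕ.* n ! ⟧     ∎
  target-scale {m′ = m′} {n′} {i′} {j′} k i⇔ j⇔ _ | no i≢m | _ =
    trans (target-off m′ n′ i′ j′ (i≢m ∘ Equivalence.to i⇔ ∘ proj₁)) (sym (zeroʳ _))
  target-scale {m′ = m′} {n′} {i′} {j′} k i⇔ j⇔ _ | yes _ | no j≢n =
    trans (target-off m′ n′ i′ j′ (j≢n ∘ Equivalence.to j⇔ ∘ proj₂)) (sym (zeroʳ _))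

  target-sucˣ : ∀ m n i j → target R (suc m) n (suc i) j ≈ ⟦ suc m ⟧ * target R m n i j
  target-sucˣ m n i j = target-scale {m} {n} {i} {j} (suc m)
    (mk⇔ ℕₚ.suc-injective (≡.cong suc)) (mk⇔ id id) (ℕₚ.*-assoc (suc m) (m !) (n !))

  target-sucʸ : ∀ m n i j → target R m (suc n) i (suc j) ≈ ⟦ suc n ⟧ * target R m n i j
  target-sucʸ m n i j = target-scale {m} {n} {i} {j} (suc n)
    (mk⇔ id id) (mk⇔ ℕₚ.suc-injective (≡.cong suc)) (x∙yz≈y∙xz (m !) (suc n) (n !))
    where open import Algebra.Properties.CommutativeSemigroup ℕₚ.*-commutativeSemigroup
            using (x∙yz≈y∙xz)

  -- Uniqueness of interpolants

  ZeroData : ℕ → ℕ → NodeSet R → Fun2 R → Set ℓ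
  ZeroData m n W p = ∀ i j → i ≤ m → j ≤ n → ε R (W i j) (Δ[ i , j ] p) ≈ 0#

  module _ (cancel : AlmostLeftCancellative 0# _*_) (charZero : CharZero R) where

    mutual
      zeroData⇒≈0 : ∀ m n W {p} → Poly₂≤ m n p → ZeroData m n W p → p ≈₂ λ _ _ → 0#
      zeroData⇒≈0 m n W {p} p≤@(pˣ , pʸ) zero-data = pointwise λ x y → begin
        p x y    ≈⟨ Poly≤-periodic⇒const cancel charZero n (pʸ x)
                      (λ t → x∙y⁻¹≈ε⇒x≈y _ _ (at (zeroData⇒Δy≈0 m n W p≤ zero-data) x t)) y₀ y ⟩
        p x y₀   ≈⟨ Poly≤-periodic⇒const cancel charZero m (pˣ y₀)
                      (λ t → x∙y⁻¹≈ε⇒x≈y _ _ (at (zeroData⇒Δx≈0 m n W p≤ zero-data) t y₀)) x₀ x ⟩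
        p x₀ y₀  ≈⟨ zero-data 0 0 z≤n z≤n ⟩
        0#       ∎
        where
        x₀ y₀ : F
        x₀ = proj₁ (W 0 0)
        y₀ = proj₂ (W 0 0)

      zeroData⇒Δx≈0 : ∀ m n W {p} → Poly₂≤ m n p → ZeroData m n W p → Δx R p ≈₂ λ _ _ → 0#
      zeroData⇒Δx≈0 zero    n W p≤ _         = Poly₂≤[0,n]⇒Δx≈0 p≤
      zeroData⇒Δx≈0 (suc m) n W {p} p≤ zero-data =
        zeroData⇒≈0 m n (LZ R W) (Poly₂≤-Δx p≤) λ i j i≤m j≤n →
          trans (ε-cong (W (suc i) j) (Δ[]-Δx i j p)) (zero-data (suc i) j (s≤s i≤m) j≤n)

      zeroData⇒Δy≈0 : ∀ m n W {p} → Poly₂≤ m n p → ZeroData m n W p → Δy R p ≈₂ λ _ _ → 0#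
      zeroData⇒Δy≈0 m zero    W p≤ _         = Poly₂≤[m,0]⇒Δy≈0 p≤
      zeroData⇒Δy≈0 m (suc n) W {p} p≤ zero-data =
        zeroData⇒≈0 m n (DZ R W) (Poly₂≤-Δy p≤) λ i j i≤m j≤n →
          trans (ε-cong (W i (suc j)) (Δ[]-Δy i j p)) (zero-data i (suc j) i≤m (s≤s j≤n))

    scaled-gtilde-unique : ∀ {m n W p q} k → IsGtilde R m n W q → Poly₂≤ m n p →
      (∀ i j → i ≤ m → j ≤ n → ε R (W i j) (Δ[ i , j ] p) ≈ k * target R m n i j) →
      p ≈₂ λ x y → k * q x y
    scaled-gtilde-unique {m} {n} {W} {p} {q} k (q∈Π , q-data) p≤ p-data = pointwise λ x y →
      x∙y⁻¹≈ε⇒x≈y _ _ (at (zeroData⇒≈0 m n W (Poly₂≤-⊝ p≤ (InΠ⇒Poly₂≤ m n q∈Π) k) zero-data) x y)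
      where
      zero-data : ZeroData m n W (p ⊝[ k ] q)
      zero-data i j i≤m j≤n = begin
        ε R w (Δ[ i , j ] (p ⊝[ k ] q))                 ≈⟨ ε-cong w (Δ[]-linear i j k p q) ⟩
        ε R w (Δ[ i , j ] p ⊝[ k ] Δ[ i , j ] q)        ≡⟨⟩
        ε R w (Δ[ i , j ] p) - k * ε R w (Δ[ i , j ] q)
          ≈⟨ +-cong (p-data i j i≤m j≤n) (-‿cong (*-congˡ (q-data i j i≤m j≤n))) ⟩
        k * target R m n i j - k * target R m n i j      ≈⟨ -‿inverseʳ _ ⟩
        0#                                               ∎
        where w = W i j

    Δx-gtilde : ∀ {m n Z p q} → IsGtilde R (suc m) n Z p → IsGtilde R m n (LZ R Z) q →
      Δx R p ≈₂ λ x y → ⟦ suc m ⟧ * q x y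
    Δx-gtilde {m} {n} {Z} {p} (p∈Π , p-data) q̃ =
      scaled-gtilde-unique ⟦ suc m ⟧ q̃ (Poly₂≤-Δx (InΠ⇒Poly₂≤ (suc m) n p∈Π)) λ i j i≤m j≤n → begin
        ε R (Z (suc i) j) (Δ[ i , j ] (Δx R p))  ≈⟨ ε-cong (Z (suc i) j) (Δ[]-Δx i j p) ⟩
        ε R (Z (suc i) j) (Δ[ suc i , j ] p)     ≈⟨ p-data (suc i) j (s≤s i≤m) j≤n ⟩
        target R (suc m) n (suc i) j             ≈⟨ target-sucˣ m n i j ⟩
        ⟦ suc m ⟧ * target R m n i j             ∎

    Δy-gtilde : ∀ {m n Z p q} → IsGtilde R m (suc n) Z p → IsGtilde R m n (DZ R Z) q →
      Δy R p ≈₂ λ x y → ⟦ suc n ⟧ * q x y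
    Δy-gtilde {m} {n} {Z} {p} (p∈Π , p-data) q̃ =
      scaled-gtilde-unique ⟦ suc n ⟧ q̃ (Poly₂≤-Δy (InΠ⇒Poly₂≤ m (suc n) p∈Π)) λ i j i≤m j≤n → begin
        ε R (Z i (suc j)) (Δ[ i , j ] (Δy R p))  ≈⟨ ε-cong (Z i (suc j)) (Δ[]-Δy i j p) ⟩
        ε R (Z i (suc j)) (Δ[ i , suc j ] p)     ≈⟨ p-data i (suc j) i≤m (s≤s j≤n) ⟩
        target R m (suc n) i (suc j)             ≈⟨ target-sucʸ m n i j ⟩
        ⟦ suc n ⟧ * target R m n i j             ∎

theorem5 : ∀ {c ℓ} (R : CommutativeRing c ℓ) → IsField R → CharZero R →
    (Z : NodeSet R) →
    ((∀ n p → IsGtilde R 0 n Z p →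
        ∀ x y → CommutativeRing._≈_ R (Δx R p x y) (CommutativeRing.0# R))
    × (∀ m n p q → IsGtilde R (suc m) n Z p → IsGtilde R m n (LZ R Z) q →
        ∀ x y → CommutativeRing._≈_ R (Δx R p x y)
                  (CommutativeRing._*_ R (⟦_⟧ℕ R (suc m)) (q x y))))
    × ((∀ m p → IsGtilde R m 0 Z p →
        ∀ x y → CommutativeRing._≈_ R (Δy R p x y) (CommutativeRing.0# R))
    × (∀ m n p q → IsGtilde R m (suc n) Z p → IsGtilde R m n (DZ R Z) q →
        ∀ x y → CommutativeRing._≈_ R (Δy R p x y)
                  (CommutativeRing._*_ R (⟦_⟧ℕ R (suc n)) (q x y))))
theorem5 R isField charZero Z =
  ( (λ n _ (p∈Π , _) → at (Poly₂≤[0,n]⇒Δx≈0 R (InΠ⇒Poly₂≤ R 0 n p∈Π)))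
  , (λ _ _ _ _ p̃ q̃ → at (Δx-gtilde R cancel charZero p̃ q̃)) )
  , ( (λ m _ (p∈Π , _) → at (Poly₂≤[m,0]⇒Δy≈0 R (InΠ⇒Poly₂≤ R m 0 p∈Π)))
  , (λ _ _ _ _ p̃ q̃ → at (Δy-gtilde R cancel charZero p̃ q̃)) )
  where
  open CommutativeRing R using (_≈_; _*_; 0#)
  open import Algebra.Definitions _≈_ using (AlmostLeftCancellative)
  cancel : AlmostLeftCancellative 0# _*_
  cancel = IsField⇒almostLeftCancellative R isField
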